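{- Let $n$ be a positive integer and $\pi\in\mathcal{C}^+_{B,n+1}$. If $0\in\mathrm{Des}(\pi)$, then $0\in\mathrm{Des}(\phi(\pi))$; moreover, in this case $\pi(1)<-1$ and $\phi(\pi)(1)<-1$.
   Context: For a positive integer $N$, $B_N$ is the group of bijections $\sigma$ of $\{\pm1,\ldots,\pm N\}$ with $\sigma(-i)=-\sigma(i)$. A cycle of $\sigma$ is written $(\epsilon_1a_1,\ldots,\epsilon_\ell a_\ell)$ with distinct $a_i\in\{1,\ldots,N\}$, $\epsilon_i\in\{\pm1\}$, $\sigma(a_i)=\epsilon_{i+1}a_{i+1}$ (indices mod $\ell$); the cycle notation of $\sigma$ is a product of such cycles whose underlying sets partition $\{1,\ldots,N\}$; $\sigma$ is cyclic if this is a single cycle of length $N$. $\mathrm{Des}(\sigma)=\{i:0\le i\le N-1,\ \sigma(i)>\sigma(i+1)\}$ with $\sigma(0)=0$. $\mathcal{C}^+_{B,n+1}$ is the set of cyclic $\pi\in B_{n+1}$ whose cycle notation contains the entry $n+1$ (rather than $-(n+1)$). For $\pi\in\mathcal{C}^+_{B,n+1}$ and $\sigma\in B_n$ let $\mathrm{Des}_\Delta(\pi,\sigma)=\mathrm{Des}(\pi)\,\triangle\,\mathrm{Des}(\sigma)$, and for nonnegative integers $x,y$ let $P_{\pi,\sigma}(x,y)$ be True iff $|x-y|=1$ and $\min\{x,y\}\in\mathrm{Des}_\Delta(\pi,\sigma)\cap\{1,\ldots,n-1\}$. The map $\phi:\mathcal{C}^+_{B,n+1}\to B_n$ is the output of the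 following algorithm on input $\pi$. (1) Write the cycle notation of $\pi$ as $(p_1,\ldots,p_n,n+1)$ and let $p_{i_1},\ldots,p_{i_{m+1}}$ ($i_1<\dots<i_{m+1}$) be its left-to-right maxima (entries larger than all entries to their left), so $i_1=1$ and $p_{i_{m+1}}=n+1$. (2) Let $\sigma=\sigma_1\cdots\sigma_m\in B_n$ with cycles $\sigma_k=(p_{i_k},\ldots,p_{i_{k+1}-1})$; $\sigma$ always denotes the current signed permutation, modified in place in this cycle notation. (3) For $j=1,\ldots,m$: let $z$ be the last entry of $\sigma_j$. If $P_{\pi,\sigma}(|z|,|z-1|)$ or $P_{\pi,\sigma}(|z|,|z+1|)$ is True, choose $\epsilon\in\{ -1,1\}$ with $P_{\pi,\sigma}(|z|,|z+\epsilon|)$ True and, among such, $\pi(|z+\epsilon|)$ largest; then while $P_{\pi,\sigma}(|z|,|z+\epsilon|)$ is True: set $x:=z$ and let $y$ be whichever of $\pm(z+\epsilon)$ appears in the cycle notation of $\sigma$; while $P_{\pi,\sigma}(|x|,|y|)$ is True, replace the entry $x$ by $\mathrm{sgn}(x)|y|$ and the entry $y$ by $\mathrm{sgn}(y)|x|$ in the cycle notation of $\sigma$, and if the replaced entry $x$ was not the first entry of $\sigma_j$, redefine $x,y$ as the entries immediately preceding the two replaced entries in their respective cycles; after this inner loop, reset $z$ to the last entry of $\sigma_j$. (4) Output $\phi(\pi)=\sigma$. -}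

module Defs where

open import Data.Bool using (Bool; true; false; if_then_else_; _∧_; _∨_; not; _xor_)
open import Data.Nat as ℕ using (ℕ; zero; suc; _∸_; _⊓_; ∣_-_∣; _≡ᵇ_)
import Data.Nat.Properties as ℕP
open import Data.Integer as ℤ using (ℤ; +_; -[1+_]; ∣_∣; sign; _◃_; 0ℤ; 1ℤ; -1ℤ)
import Data.Integer.Properties as ℤP
open import Data.List using (List; []; _∷_; _++_; [_]; map; length; zip; concatMap; upTo; foldl)
open import Data.List.Relation.Unary.All using (All)
open import Data.List.Relation.Binary.Permutation.Propositional using (_↭_)
open import Data.Maybe using (Maybe; just; nothing; _>>=_)
open import Data.Product using (_×_; _,_; proj₁; proj₂)
open import Relation.Nullary using (Dec; does; ¬_)
open import Relation.Nullary.Decidable using (_×-dec_)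
open import Relation.Binary.PropositionalEquality using (_≡_)

-- A signed permutation w ∈ B_N is stored as the list [w(1), …, w(N)];
-- w(-i) = -w(i) is then implicit.  Values at i ≥ 0 are read by `listApp`
-- with the convention w(0) = 0.

nth : {A : Set} → A → List A → ℕ → A
nth d []       _       = d
nth d (x ∷ _)  zero    = x
nth d (_ ∷ xs) (suc i) = nth d xs i

listApp : List ℤ → ℕ → ℤ
listApp w zero    = 0ℤ
listApp w (suc i) = nth 0ℤ w i

IsSignedPerm : ℕ → List ℤ → Set
IsSignedPerm N w = map ∣_∣ w ↭ map suc (upTo N)

-- A cycle (ε₁a₁,…,ε_ℓa_ℓ) is a list of nonzero integers; the condition
-- σ(a_i) = ε_{i+1} a_{i+1} (indices mod ℓ) says: for every entry e with
-- cyclic successor e', σ(|e|) = e'.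

rot : List ℤ → List ℤ
rot []       = []
rot (x ∷ xs) = xs ++ [ x ]

succPairs : List ℤ → List (ℤ × ℤ)
succPairs c = zip c (rot c)

IsCycle : (ℕ → ℤ) → List ℤ → Set
IsCycle σ c = (¬ (c ≡ [])) × All (λ q → σ ∣ proj₁ q ∣ ≡ proj₂ q) (succPairs c)

IsCycleNotation : ℕ → (ℕ → ℤ) → List (List ℤ) → Set
IsCycleNotation N σ cs = All (IsCycle σ) cs × (concatMap (map ∣_∣) cs ↭ map suc (upTo N))

CycleNotation : Set
CycleNotation = List (List ℤ)

findNext : List (ℤ × ℤ) → ℕ → ℤ
findNext []             i = 0ℤ
findNext ((e , e') ∷ r) i = if ∣ e ∣ ≡ᵇ i then e' else findNext r i

cnApp : CycleNotation → ℕ → ℤ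
cnApp cs zero    = 0ℤ
cnApp cs (suc i) = findNext (concatMap succPairs cs) (suc i)

Des : ℕ → (ℕ → ℤ) → ℕ → Set
Des N σ i = (i ℕ.< N) × (σ (suc i) ℤ.< σ i)

des? : ∀ N σ i → Dec (Des N σ i)
des? N σ i = (i ℕ.<? N) ×-dec (σ (suc i) ℤ.<? σ i)

desB : ℕ → (ℕ → ℤ) → ℕ → Bool
desB N σ i = does (des? N σ i)

-- Left-to-right maxima splitting of (p₁,…,p_n): cycles σ_k start at the
-- left-to-right maxima p_{i_k}.

splitGo : ℤ → List ℤ → List (List ℤ) → List ℤ → List (List ℤ)
splitGo m cur acc []       = acc ++ [ cur ]
splitGo m cur acc (y ∷ ys) =
  if does (m ℤ.<? y) then splitGo y [ y ] (acc ++ [ cur ]) ys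
                     else splitGo m (cur ++ [ y ]) acc ys

splitLTR : List ℤ → List (List ℤ)
splitLTR []       = []
splitLTR (x ∷ xs) = splitGo x [ x ] [] xs

Pos : Set
Pos = ℕ × ℕ

getE : CycleNotation → Pos → ℤ
getE cs (j , k) = nth 0ℤ (nth [] cs j) k

setAt : {A : Set} → List A → ℕ → (A → A) → List A
setAt []       _       f = []
setAt (x ∷ xs) zero    f = f x ∷ xs
setAt (x ∷ xs) (suc i) f = x ∷ setAt xs i f

setE : CycleNotation → Pos → ℤ → CycleNotation
setE cs (j , k) v = setAt cs j (λ c → setAt c k (λ _ → v))

findInCycle : List ℤ → ℕ → ℕ → Maybe ℕ
findInCycle []       v k = nothing
findInCycle (e ∷ es) v k = if ∣ e ∣ ≡ᵇ v then just k else findInCycle es v (suc k)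

findAbsFrom : CycleNotation → ℕ → ℕ → Maybe Pos
findAbsFrom []       v j = nothing
findAbsFrom (c ∷ cs) v j with findInCycle c v 0
... | just k  = just (j , k)
... | nothing = findAbsFrom cs v (suc j)

findAbs : CycleNotation → ℕ → Maybe Pos
findAbs cs v = findAbsFrom cs v 0

cycLen : CycleNotation → ℕ → ℕ
cycLen cs j = length (nth [] cs j)

lastPos : CycleNotation → ℕ → Pos
lastPos cs j = (j , cycLen cs j ∸ 1)

predPos : CycleNotation → Pos → Pos
predPos cs (j , zero)  = (j , cycLen cs j ∸ 1)
predPos cs (j , suc k) = (j , k)

-- The map φ, executed with a fuel bound (every while-loop iteration
-- consumes one unit of fuel; `nothing` = fuel exhausted).  φ(π) = σ means
-- `phi n π k p ≡ just σ` for some fuel k, where the cycle notation of π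
-- is (p₁,…,p_n,n+1) and p = [p₁,…,p_n].

module Alg (n : ℕ) (π : List ℤ) where

  πf : ℕ → ℤ
  πf = listApp π

  P : CycleNotation → ℕ → ℕ → Bool
  P cs x y =
    (∣ x - y ∣ ≡ᵇ 1) ∧
    (not (m ≡ᵇ 0) ∧ (does (m ℕ.≤? n ∸ 1) ∧
      (desB (suc n) πf m xor desB n (cnApp cs) m)))
    where m = x ⊓ y

  inner : ℕ → Pos → Pos → CycleNotation → Maybe CycleNotation
  inner zero    xp yp cs = nothing
  inner (suc k) xp yp cs =
    if P cs ∣ x ∣ ∣ y ∣
      then (if proj₂ xp ≡ᵇ 0 then inner k xp yp cs'
                             else inner k (predPos cs' xp) (predPos cs' yp) cs')
      else just cs
    where
      x = getE cs xp
      y = getE cs yp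
      cs' = setE (setE cs xp (sign x ◃ ∣ y ∣)) yp (sign y ◃ ∣ x ∣)

  outerLoop : ℕ → ℕ → ℤ → CycleNotation → Maybe CycleNotation
  outerLoop zero    j ε cs = nothing
  outerLoop (suc k) j ε cs =
    if P cs ∣ z ∣ t
      then (findAbs cs t >>= λ yp → inner k zp yp cs >>= outerLoop k j ε)
      else just cs
    where
      zp = lastPos cs j
      z  = getE cs zp
      t  = ∣ z ℤ.+ ε ∣

  step : ℕ → ℕ → CycleNotation → Maybe CycleNotation
  step k j cs =
    if bm ∨ bp
      then outerLoop k j ε cs
      else just cs
    where
      z  = getE cs (lastPos cs j)
      bm = P cs ∣ z ∣ ∣ z ℤ.- 1ℤ ∣
      bp = P cs ∣ z ∣ ∣ z ℤ.+ 1ℤ ∣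
      ε  = if bm ∧ bp
             then (if does (πf ∣ z ℤ.- 1ℤ ∣ ℤ.<? πf ∣ z ℤ.+ 1ℤ ∣) then 1ℤ else -1ℤ)
             else (if bp then 1ℤ else -1ℤ)

  phi : ℕ → List ℤ → Maybe CycleNotation
  phi k p = foldl (λ acc j → acc >>= step k j) (just cs₀) (upTo (length cs₀))
    where cs₀ = splitLTR p

phi : ℕ → List ℤ → ℕ → List ℤ → Maybe CycleNotation
phi n π k p = Alg.phi n π k p

-- Every swap made by φ exchanges entries of absolute values m and m+1, where 1 ≤ m ≤ n−1 and
-- exactly one of π and the current σ has a descent at m; since the absolute values of the entries
-- are distinct, this conjugates σ by the transposition (m m+1).  The invariant carried through the
-- algorithm is: if π has descents at 0, 1, …, i then σ(i+1) < −(i+1).  Initially it holds because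
-- π(1) ≠ ±1 (so π(1) < −1 and a run of descents keeps π(i+1) < −(i+1)), and the step of the cycle
-- of π out of ±(i+1) is then a descent, which survives the splitting at left-to-right maxima.
-- Conjugation by (m m+1) preserves it: the only delicate case i+1 = m needs σ(m+1) < −(m+1), which
-- follows from the invariant at m when π descends at m, and from the descent of σ at m otherwise.
-- Taking i = 0 gives φ(π)(1) < −1, hence 0 ∈ Des(φ(π)).

module Submission where

open import Defs
open import Data.Bool using (true; false; if_then_else_; T; _∧_; not; _xor_)
open import Data.Bool.Properties using (T-≡; T-∧)
open import Data.Nat as ℕ using (ℕ; zero; suc; _≤_; _≡ᵇ_; _∸_; _⊓_; ∣_-_∣)
import Data.Nat.Properties as ℕP
open import Data.Integer as ℤ using (ℤ; +_; -[1+_]; ∣_∣; sign; _◃_; _<_; 0ℤ; -1ℤ)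
import Data.Integer.Properties as ℤP
open import Data.List using (List; []; _∷_; _++_; [_]; map; length; concat; concatMap; zip; foldl; upTo)
import Data.List.Properties as LP
open import Data.List.Relation.Unary.Unique.Propositional using (Unique)
import Data.List.Relation.Unary.Unique.Propositional.Properties as Unique
open import Data.List.Membership.Propositional using (_∈_; _∉_)
open import Data.List.Membership.Propositional.Properties using (∈-++⁺ˡ; ∈-++⁺ʳ; ∈-++⁻; ∈-map⁺; ∈-map⁻; ∈-upTo⁺)
open import Data.List.Relation.Unary.Any using (here; there)
import Data.List.Relation.Unary.All as All
open import Data.List.Relation.Unary.AllPairs using ([]; _∷_)
import Data.List.Relation.Unary.All.Properties as All
open import Data.List.Relation.Binary.Permutation.Propositional using (↭-sym; ↭⇒↭ₛ)
open import Data.List.Relation.Binary.Permutation.Propositional.Properties using (∈-resp-↭)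
open import Data.Maybe using (Maybe; just; nothing; _>>=_)
open import Data.Maybe.Properties using (just-injective)
open import Data.Product.Properties using (≡-dec)
open import Data.Product as Prod using (_×_; _,_; proj₁; proj₂; ∃-syntax)
open import Data.Sum as Sum using (_⊎_; inj₁; inj₂)
open import Function using (_∘_; id; _⇔_; mk⇔; Equivalence)
open Equivalence using (to; from)
open import Relation.Nullary using (¬_; Dec; does; yes; no; contradiction)
open import Relation.Nullary.Decidable using (dec-true; dec-false; does-⇔)
open import Relation.Binary.PropositionalEquality hiding ([_])
open import Data.List.Relation.Binary.Permutation.Setoid.Properties (setoid ℕ) using (Unique-resp-↭)

≡ᵇ-refl : ∀ m → (m ≡ᵇ m) ≡ true
≡ᵇ-refl m = dec-true (m ℕ.≟ m) refl

≢⇒≡ᵇ-false : ∀ {m n} → m ≢ n → (m ≡ᵇ n) ≡ false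
≢⇒≡ᵇ-false {m} {n} = dec-false (m ℕ.≟ n)

-- Transpositions and relabelling

transpose : ℕ → ℕ → ℕ → ℕ
transpose a b u = if u ≡ᵇ a then b else if u ≡ᵇ b then a else u

transpose-left : ∀ a b → transpose a b a ≡ b
transpose-left a b rewrite ≡ᵇ-refl a = refl

transpose-right : ∀ a b → transpose a b b ≡ a
transpose-right a b with b ℕ.≟ a
... | yes refl rewrite ≡ᵇ-refl b = refl
... | no b≢a rewrite ≢⇒≡ᵇ-false b≢a | ≡ᵇ-refl b = refl

transpose-other : ∀ {a b u} → u ≢ a → u ≢ b → transpose a b u ≡ u
transpose-other u≢a u≢b rewrite ≢⇒≡ᵇ-false u≢a | ≢⇒≡ᵇ-false u≢b = refl

transpose-involutive : ∀ a b u → transpose a b (transpose a b u) ≡ u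
transpose-involutive a b u with u ℕ.≟ a
... | yes refl = trans (cong (transpose u b) (transpose-left u b)) (transpose-right u b)
... | no u≢a with u ℕ.≟ b
...   | yes refl = trans (cong (transpose a u) (transpose-right a u)) (transpose-left a u)
...   | no u≢b = trans (cong (transpose a b) (transpose-other u≢a u≢b)) (transpose-other u≢a u≢b)

transpose-comm : ∀ a b u → transpose a b u ≡ transpose b a u
transpose-comm a b u with u ℕ.≟ a
... | yes refl = trans (transpose-left u b) (sym (transpose-right b u))
... | no u≢a with u ℕ.≟ b
...   | yes refl = trans (transpose-right a u) (sym (transpose-left u a))
...   | no u≢b = trans (transpose-other u≢a u≢b) (sym (transpose-other u≢b u≢a))

transpose-zero : ∀ {a b} → a ≢ 0 → b ≢ 0 → transpose a b 0 ≡ 0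
transpose-zero a≢0 b≢0 = transpose-other (a≢0 ∘ sym) (b≢0 ∘ sym)

rot-map : ∀ (f : ℤ → ℤ) c → rot (map f c) ≡ map f (rot c)
rot-map f []       = refl
rot-map f (x ∷ xs) = sym (LP.map-++ f xs [ x ])

succPairs-map : ∀ f c → succPairs (map f c) ≡ map (Prod.map f f) (succPairs c)
succPairs-map f c = trans (cong (zip (map f c)) (rot-map f c)) (LP.zip-map f f c (rot c))

concatMap-succPairs-map : ∀ f cs →
  concatMap succPairs (map (map f) cs) ≡ map (Prod.map f f) (concatMap succPairs cs)
concatMap-succPairs-map f cs = begin
  concatMap succPairs (map (map f) cs)            ≡⟨ LP.concatMap-map succPairs (map f) cs ⟩
  concatMap (succPairs ∘ map f) cs                ≡⟨ LP.concatMap-cong (succPairs-map f) cs ⟩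
  concatMap (map (Prod.map f f) ∘ succPairs) cs   ≡⟨ LP.map-concatMap (Prod.map f f) succPairs cs ⟨
  map (Prod.map f f) (concatMap succPairs cs)     ∎
  where open ≡-Reasoning

relabel : (ℕ → ℕ) → ℤ → ℤ
relabel g e = sign e ◃ g ∣ e ∣

∣relabel∣ : ∀ g e → ∣ relabel g e ∣ ≡ g ∣ e ∣
∣relabel∣ g e = ℤP.abs-◃ (sign e) (g ∣ e ∣)

absEntries : CycleNotation → List ℕ
absEntries = concatMap (map ∣_∣)

absEntries-relabel : ∀ g cs → absEntries (map (map (relabel g)) cs) ≡ map g (absEntries cs)
absEntries-relabel g cs = begin
  concatMap (map ∣_∣) (map (map (relabel g)) cs)  ≡⟨ LP.concatMap-map (map ∣_∣) (map (relabel g)) cs ⟩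
  concatMap (map ∣_∣ ∘ map (relabel g)) cs        ≡⟨ LP.concatMap-cong map-abs-relabel cs ⟩
  concatMap (map g ∘ map ∣_∣) cs                  ≡⟨ LP.map-concatMap g (map ∣_∣) cs ⟨
  map g (concatMap (map ∣_∣) cs)                  ∎
  where
  open ≡-Reasoning
  map-abs-relabel : ∀ c → map ∣_∣ (map (relabel g) c) ≡ map g (map ∣_∣ c)
  map-abs-relabel c = trans (sym (LP.map-∘ c)) (trans (LP.map-cong (∣relabel∣ g) c) (LP.map-∘ c))

module Relabel (g : ℕ → ℕ) (g-involutive : ∀ u → g (g u) ≡ u) (g-zero : g 0 ≡ 0) where

  relabel-zero : relabel g 0ℤ ≡ 0ℤ
  relabel-zero = cong (sign 0ℤ ◃_) g-zero

  g-injective : ∀ {u v} → g u ≡ g v → u ≡ v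
  g-injective {u} {v} eq = trans (sym (g-involutive u)) (trans (cong g eq) (g-involutive v))

  ∣relabel∣≡⇔≡g : ∀ e v → ∣ relabel g e ∣ ≡ v ⇔ ∣ e ∣ ≡ g v
  ∣relabel∣≡⇔≡g e v = mk⇔
    (λ eq → trans (sym (g-involutive ∣ e ∣)) (cong g (trans (sym (∣relabel∣ g e)) eq)))
    (λ eq → trans (∣relabel∣ g e) (trans (cong g eq) (g-involutive v)))

  findNext-relabel : ∀ ps v →
    findNext (map (Prod.map (relabel g) (relabel g)) ps) v ≡ relabel g (findNext ps (g v))
  findNext-relabel []             v = sym relabel-zero
  findNext-relabel ((e , e′) ∷ ps) v
    rewrite does-⇔ (∣relabel∣≡⇔≡g e v) (∣ relabel g e ∣ ℕ.≟ v) (∣ e ∣ ℕ.≟ g v)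
    with ∣ e ∣ ≡ᵇ g v
  ... | true  = refl
  ... | false = findNext-relabel ps v

  cnApp-relabel : ∀ cs v → cnApp (map (map (relabel g)) cs) v ≡ relabel g (cnApp cs (g v))
  cnApp-relabel cs zero    rewrite g-zero = sym relabel-zero
  cnApp-relabel cs (suc i) with g (suc i) in gi
  ... | zero  = contradiction (trans (sym (g-involutive (suc i))) (trans (cong g gi) g-zero)) λ ()
  ... | suc j = begin
    findNext (concatMap succPairs (map (map (relabel g)) cs)) (suc i)
      ≡⟨ cong (λ ps → findNext ps (suc i)) (concatMap-succPairs-map (relabel g) cs) ⟩
    findNext (map (Prod.map (relabel g) (relabel g)) (concatMap succPairs cs)) (suc i)
      ≡⟨ findNext-relabel (concatMap succPairs cs) (suc i) ⟩
    relabel g (findNext (concatMap succPairs cs) (g (suc i)))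
      ≡⟨ cong (relabel g ∘ findNext (concatMap succPairs cs)) gi ⟩
    relabel g (findNext (concatMap succPairs cs) (suc j))
      ∎
    where open ≡-Reasoning

  unique-relabel : ∀ {cs} → Unique (absEntries cs) → Unique (absEntries (map (map (relabel g)) cs))
  unique-relabel {cs} u = subst Unique (sym (absEntries-relabel g cs)) (Unique.map⁺ g-injective u)

-- Swapping two entries of a cycle notation

Unique-++⁻ˡ : ∀ (xs : List ℕ) {ys} → Unique (xs ++ ys) → Unique xs
Unique-++⁻ˡ []       _        = []
Unique-++⁻ˡ (x ∷ xs) (px ∷ u) = All.++⁻ˡ xs px ∷ Unique-++⁻ˡ xs u

Unique-++⁻ʳ : ∀ (xs : List ℕ) {ys} → Unique (xs ++ ys) → Unique ys
Unique-++⁻ʳ []       u       = u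
Unique-++⁻ʳ (x ∷ xs) (_ ∷ u) = Unique-++⁻ʳ xs u

Unique-++⇒disjoint : ∀ (xs : List ℕ) {ys x} → Unique (xs ++ ys) → x ∈ xs → x ∉ ys
Unique-++⇒disjoint (x ∷ xs) (px ∷ u) (here refl) x∈ys = All.lookup (All.++⁻ʳ xs px) x∈ys refl
Unique-++⇒disjoint (x ∷ xs) (px ∷ u) (there x∈xs)   = Unique-++⇒disjoint xs u x∈xs

nth-∈ : ∀ (c : List ℤ) {k} → k ℕ.< length c → ∣ nth 0ℤ c k ∣ ∈ map ∣_∣ c
nth-∈ (e ∷ es) {zero}  _           = here refl
nth-∈ (e ∷ es) {suc k} (ℕ.s≤s k<) = there (nth-∈ es k<)

∣nth∣-injective : ∀ c → Unique (map ∣_∣ c) → ∀ {k k′} → k ℕ.< length c → k′ ℕ.< length c →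
                 ∣ nth 0ℤ c k ∣ ≡ ∣ nth 0ℤ c k′ ∣ → k ≡ k′
∣nth∣-injective (e ∷ es) (pe ∷ u) {zero}  {zero}   _          _           _  = refl
∣nth∣-injective (e ∷ es) (pe ∷ u) {zero}  {suc k′} _          (ℕ.s≤s k′<) eq = contradiction eq (All.lookup pe (nth-∈ es k′<))
∣nth∣-injective (e ∷ es) (pe ∷ u) {suc k} {zero}   (ℕ.s≤s k<) _           eq = contradiction (sym eq) (All.lookup pe (nth-∈ es k<))
∣nth∣-injective (e ∷ es) (pe ∷ u) {suc k} {suc k′} (ℕ.s≤s k<) (ℕ.s≤s k′<) eq = cong suc (∣nth∣-injective es u k< k′< eq)

ValidPos : CycleNotation → Pos → Set
ValidPos cs (j , k) = k ℕ.< cycLen cs j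

getE-∈ : ∀ cs {p} → ValidPos cs p → ∣ getE cs p ∣ ∈ absEntries cs
getE-∈ (c ∷ cs) {zero  , k} k< = ∈-++⁺ˡ (nth-∈ c k<)
getE-∈ (c ∷ cs) {suc j , k} k< = ∈-++⁺ʳ (map ∣_∣ c) (getE-∈ cs k<)

nonzero⇒ValidPos : ∀ cs p → ∣ getE cs p ∣ ≢ 0 → ValidPos cs p
nonzero⇒ValidPos []       p           e≢0 = contradiction refl e≢0
nonzero⇒ValidPos (c ∷ cs) (suc j , k) e≢0 = nonzero⇒ValidPos cs (j , k) e≢0
nonzero⇒ValidPos (c ∷ cs) (zero  , k) e≢0 = go c k e≢0
  where
  go : ∀ c k → ∣ nth 0ℤ c k ∣ ≢ 0 → k ℕ.< length c
  go []       k       e≢0 = contradiction refl e≢0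
  go (e ∷ es) zero    _   = ℕ.s≤s ℕ.z≤n
  go (e ∷ es) (suc k) e≢0 = ℕ.s≤s (go es k e≢0)

∣getE∣-injective : ∀ cs → Unique (absEntries cs) → ∀ {p q} → ValidPos cs p → ValidPos cs q →
                  ∣ getE cs p ∣ ≡ ∣ getE cs q ∣ → p ≡ q
∣getE∣-injective (c ∷ cs) u {zero  , k} {zero  , k′} k< k′< eq =
  cong (zero ,_) (∣nth∣-injective c (Unique-++⁻ˡ (map ∣_∣ c) u) k< k′< eq)
∣getE∣-injective (c ∷ cs) u {zero  , k} {suc j , k′} k< k′< eq =
  contradiction (subst (_∈ _) (sym eq) (getE-∈ cs k′<)) (Unique-++⇒disjoint (map ∣_∣ c) u (nth-∈ c k<))
∣getE∣-injective (c ∷ cs) u {suc j , k} {zero  , k′} k< k′< eq =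
  contradiction (subst (_∈ _) eq (getE-∈ cs k<)) (Unique-++⇒disjoint (map ∣_∣ c) u (nth-∈ c k′<))
∣getE∣-injective (c ∷ cs) u {suc j , k} {suc j′ , k′} k< k′< eq =
  cong (Prod.map suc id) (∣getE∣-injective cs (Unique-++⁻ʳ (map ∣_∣ c) u) k< k′< eq)

imap : (ℕ → ℤ → ℤ) → List ℤ → List ℤ
imap f []       = []
imap f (e ∷ es) = f 0 e ∷ imap (f ∘ suc) es

imap-cong : ∀ c {f f′} → (∀ {k} → k ℕ.< length c → f k (nth 0ℤ c k) ≡ f′ k (nth 0ℤ c k)) →
            imap f c ≡ imap f′ c
imap-cong []       _  = refl
imap-cong (e ∷ es) eq = cong₂ _∷_ (eq (ℕ.s≤s ℕ.z≤n)) (imap-cong es (eq ∘ ℕ.s≤s))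

imap-∘ : ∀ c f f′ → imap f (imap f′ c) ≡ imap (λ k → f k ∘ f′ k) c
imap-∘ []       f f′ = refl
imap-∘ (e ∷ es) f f′ = cong (_ ∷_) (imap-∘ es (f ∘ suc) (f′ ∘ suc))

imap-const : ∀ c f → imap (λ _ → f) c ≡ map f c
imap-const []       f = refl
imap-const (e ∷ es) f = cong (_ ∷_) (imap-const es f)

imap-identity : ∀ c {f} → (∀ k e → f k e ≡ e) → imap f c ≡ c
imap-identity []       eq = refl
imap-identity (e ∷ es) eq = cong₂ _∷_ (eq 0 e) (imap-identity es (eq ∘ suc))

imap² : (Pos → ℤ → ℤ) → CycleNotation → CycleNotation
imap² F []       = []
imap² F (c ∷ cs) = imap (λ k → F (0 , k)) c ∷ imap² (F ∘ Prod.map₁ suc) cs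

imap²-cong : ∀ cs {F F′} → (∀ {p} → ValidPos cs p → F p (getE cs p) ≡ F′ p (getE cs p)) →
             imap² F cs ≡ imap² F′ cs
imap²-cong []       _  = refl
imap²-cong (c ∷ cs) eq = cong₂ _∷_ (imap-cong c eq) (imap²-cong cs eq)

imap²-∘ : ∀ cs F F′ → imap² F (imap² F′ cs) ≡ imap² (λ p → F p ∘ F′ p) cs
imap²-∘ []       F F′ = refl
imap²-∘ (c ∷ cs) F F′ = cong₂ _∷_ (imap-∘ c _ _) (imap²-∘ cs _ _)

imap²-const : ∀ cs f → imap² (λ _ → f) cs ≡ map (map f) cs
imap²-const []       f = refl
imap²-const (c ∷ cs) f = cong₂ _∷_ (imap-const c f) (imap²-const cs f)

imap²-identity : ∀ cs {F} → (∀ p e → F p e ≡ e) → imap² F cs ≡ cs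
imap²-identity []       eq = refl
imap²-identity (c ∷ cs) eq = cong₂ _∷_ (imap-identity c (λ k → eq (0 , k))) (imap²-identity cs (eq ∘ Prod.map₁ suc))

updateAt : Pos → ℤ → Pos → ℤ → ℤ
updateAt (j , k) v (j′ , k′) e = if (j′ ≡ᵇ j) ∧ (k′ ≡ᵇ k) then v else e

updateAt-here : ∀ p v e → updateAt p v p e ≡ v
updateAt-here (j , k) v e rewrite ≡ᵇ-refl j | ≡ᵇ-refl k = refl

updateAt-elsewhere : ∀ {p q} v e → q ≢ p → updateAt p v q e ≡ e
updateAt-elsewhere {j , k} {j′ , k′} v e q≢p with j′ ℕ.≟ j
... | no j′≢j rewrite ≢⇒≡ᵇ-false j′≢j = refl
... | yes refl rewrite ≡ᵇ-refl j′ | ≢⇒≡ᵇ-false {k′} {k} (q≢p ∘ cong (j′ ,_)) = refl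

setAt-imap : ∀ c k v → setAt c k (λ _ → v) ≡ imap (λ k′ e → if k′ ≡ᵇ k then v else e) c
setAt-imap []       k       v = refl
setAt-imap (e ∷ es) zero    v = cong (v ∷_) (sym (imap-identity es λ _ _ → refl))
setAt-imap (e ∷ es) (suc k) v = cong (e ∷_) (setAt-imap es k v)

setE-imap² : ∀ cs p v → setE cs p v ≡ imap² (updateAt p v) cs
setE-imap² []       p           v = refl
setE-imap² (c ∷ cs) (zero  , k) v = cong₂ _∷_ (setAt-imap c k v) (sym (imap²-identity cs λ _ _ → refl))
setE-imap² (c ∷ cs) (suc j , k) v = cong₂ _∷_ (sym (imap-identity c λ _ _ → refl)) (setE-imap² cs (j , k) v)

swapEntries≡relabel : ∀ cs xp yp → Unique (absEntries cs) →
  ∣ getE cs xp ∣ ≢ 0 → ∣ getE cs yp ∣ ≢ 0 →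
  let x = getE cs xp ; y = getE cs yp in
  setE (setE cs xp (sign x ◃ ∣ y ∣)) yp (sign y ◃ ∣ x ∣) ≡ map (map (relabel (transpose ∣ x ∣ ∣ y ∣))) cs
swapEntries≡relabel cs xp yp u x≢0 y≢0 = begin
  setE (setE cs xp X) yp Y                            ≡⟨ cong (λ cs′ → setE cs′ yp Y) (setE-imap² cs xp X) ⟩
  setE (imap² (updateAt xp X) cs) yp Y                ≡⟨ setE-imap² _ yp Y ⟩
  imap² (updateAt yp Y) (imap² (updateAt xp X) cs)    ≡⟨ imap²-∘ cs (updateAt yp Y) (updateAt xp X) ⟩
  imap² (λ p → updateAt yp Y p ∘ updateAt xp X p) cs  ≡⟨ imap²-cong cs swap-at ⟩
  imap² (λ _ → relabel τ) cs                          ≡⟨ imap²-const cs (relabel τ) ⟩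
  map (map (relabel τ)) cs                            ∎
  where
  open ≡-Reasoning
  x = getE cs xp
  y = getE cs yp
  X = sign x ◃ ∣ y ∣
  Y = sign y ◃ ∣ x ∣
  τ = transpose ∣ x ∣ ∣ y ∣
  injective : ∀ {p q} → ValidPos cs p → ∣ getE cs p ∣ ≢ 0 → ∣ getE cs q ∣ ≡ ∣ getE cs p ∣ → q ≡ p
  injective {p} {q} p-valid p≢0 eq =
    ∣getE∣-injective cs u (nonzero⇒ValidPos cs q (p≢0 ∘ trans (sym eq))) p-valid eq
  swap-at : ∀ {p} → ValidPos cs p → updateAt yp Y p (updateAt xp X p (getE cs p)) ≡ relabel τ (getE cs p)
  swap-at {p} p-valid with ≡-dec ℕ._≟_ ℕ._≟_ p yp
  ... | yes refl = trans (updateAt-here p Y _) (sym (cong (sign y ◃_) (transpose-right ∣ x ∣ ∣ y ∣)))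
  ... | no p≢yp rewrite updateAt-elsewhere Y (updateAt xp X p (getE cs p)) p≢yp
    with ≡-dec ℕ._≟_ ℕ._≟_ p xp
  ...   | yes refl = trans (updateAt-here p X _) (sym (cong (sign x ◃_) (transpose-left ∣ x ∣ ∣ y ∣)))
  ...   | no p≢xp = begin
    updateAt xp X p (getE cs p)              ≡⟨ updateAt-elsewhere X (getE cs p) p≢xp ⟩
    getE cs p                                ≡⟨ ℤP.◃-inverse (getE cs p) ⟨
    sign (getE cs p) ◃ ∣ getE cs p ∣         ≡⟨ cong (sign (getE cs p) ◃_) (transpose-other
                                                   (p≢xp ∘ injective (nonzero⇒ValidPos cs xp x≢0) x≢0)
                                                   (p≢yp ∘ injective (nonzero⇒ValidPos cs yp y≢0) y≢0)) ⟨
    relabel τ (getE cs p)                    ∎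

-- Descent runs

DescentRun : (ℕ → ℤ) → ℕ → Set
DescentRun π k = ∀ {j} → j ℕ.< k → π (suc j) < π j

DescentRun-extend : ∀ {π k} → DescentRun π k → π (suc k) < π k → DescentRun π (suc k)
DescentRun-extend run d j<1+k with ℕP.m<1+n⇒m<n∨m≡n j<1+k
... | inj₁ j<k  = run j<k
... | inj₂ refl = d

NegBound : ℕ → (ℕ → ℤ) → (ℕ → ℤ) → Set
NegBound n π σ = ∀ i → suc i ≤ n → DescentRun π (suc i) → σ (suc i) < -[1+ i ]

x<-[1+i]⇒x≤-[2+i] : ∀ {e i} → e < -[1+ i ] → e ℤ.≤ -[1+ suc i ]
x<-[1+i]⇒x≤-[2+i] (ℤ.-<- i<w) = ℤ.-≤- i<w

DescentRun-one : ∀ {π} → π 1 < π 0 → DescentRun π 1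
DescentRun-one = DescentRun-extend λ ()

descentRun-below : ∀ {π} → π 1 < -1ℤ → ∀ i → DescentRun π (suc i) → π (suc i) < -[1+ i ]
descentRun-below π1< zero    _   = π1<
descentRun-below π1< (suc i) run =
  ℤP.<-≤-trans (run (ℕP.n<1+n (suc i))) (x<-[1+i]⇒x≤-[2+i] (descentRun-below π1< i (run ∘ ℕP.m<n⇒m<1+n)))

<-transpose-suc : ∀ {k w} m → k ℕ.< w → k ≢ m → k ℕ.< transpose m (suc m) w
<-transpose-suc {k} {w} m k<w k≢m with w ℕ.≟ m
... | yes refl = subst (k ℕ.<_) (sym (transpose-left w (suc w))) (ℕP.m<n⇒m<1+n k<w)
... | no w≢m with w ℕ.≟ suc m
...   | yes refl = subst (k ℕ.<_) (sym (transpose-right m w)) (ℕP.≤∧≢⇒< (ℕP.≤-pred k<w) k≢m)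
...   | no w≢1+m = subst (k ℕ.<_) (sym (transpose-other w≢m w≢1+m)) k<w

relabel-transpose-< : ∀ {i e} m → suc i ≢ m → e < -[1+ i ] → relabel (transpose m (suc m)) e < -[1+ i ]
relabel-transpose-< {i} m 1+i≢m (ℤ.-<- {w} i<w) with transpose m (suc m) (suc w) | <-transpose-suc m (ℕ.s≤s i<w) 1+i≢m
... | suc u | ℕ.s≤s i<u = ℤ.-<- i<u

negBound-conjugate : ∀ {n π σ σ′} m → suc m ≤ n →
  (π (suc m) < π m → ¬ σ (suc m) < σ m) → (¬ π (suc m) < π m → σ (suc m) < σ m) →
  (∀ v → σ′ v ≡ relabel (transpose m (suc m)) (σ (transpose m (suc m) v))) →
  NegBound n π σ → NegBound n π σ′
negBound-conjugate {π = π} {σ} {σ′} m 1+m≤n π-des⇒σ-asc π-asc⇒σ-des conj bound i 1+i≤n run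
  with i ℕ.≟ m | suc i ℕ.≟ m
... | yes refl | _ = subst (_< -[1+ i ]) (sym σ′[1+m]) (relabel-transpose-< m ℕP.1+n≢n σm<)
  where
  τ = transpose m (suc m)
  σ′[1+m] : σ′ (suc m) ≡ relabel τ (σ m)
  σ′[1+m] = trans (conj (suc m)) (cong (relabel τ ∘ σ) (transpose-right m (suc m)))
  σm< : σ m < -[1+ m ]
  σm< = ℤP.≤-<-trans (ℤP.≮⇒≥ (π-des⇒σ-asc (run (ℕP.n<1+n m)))) (bound m 1+i≤n run)
... | no _ | yes refl = subst (_< -[1+ i ]) (sym σ′[m]) (ℤP.<-trans (relabel-transpose-< m ℕP.1+n≢n σ[1+m]<) (ℤ.-<- (ℕP.n<1+n i)))
  where
  τ = transpose m (suc m)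
  σ′[m] : σ′ m ≡ relabel τ (σ (suc m))
  σ′[m] = trans (conj m) (cong (relabel τ ∘ σ) (transpose-left m (suc m)))
  σ[1+m]< : σ (suc m) < -[1+ m ]
  σ[1+m]< with π (suc m) ℤ.<? π m
  ... | yes d = bound m 1+m≤n (DescentRun-extend run d)
  ... | no ¬d = ℤP.<-≤-trans (π-asc⇒σ-des ¬d) (x<-[1+i]⇒x≤-[2+i] (bound i 1+i≤n run))
... | no i≢m | no 1+i≢m = subst (_< -[1+ i ]) (sym σ′[1+i]) (relabel-transpose-< m 1+i≢m (bound i 1+i≤n run))
  where
  τ = transpose m (suc m)
  σ′[1+i] : σ′ (suc i) ≡ relabel τ (σ (suc i))
  σ′[1+i] = trans (conj (suc i)) (cong (relabel τ ∘ σ) (transpose-other 1+i≢m (i≢m ∘ ℕP.suc-injective)))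

-- The steps of φ

∣-∣≡1⇒adjacent : ∀ a b → ∣ a - b ∣ ≡ 1 →
  (a ≡ a ⊓ b × b ≡ suc (a ⊓ b)) ⊎ (a ≡ suc (a ⊓ b) × b ≡ a ⊓ b)
∣-∣≡1⇒adjacent zero    b       b≡1 = inj₁ (refl , b≡1)
∣-∣≡1⇒adjacent (suc a) zero    a≡0 = inj₂ (a≡0 , refl)
∣-∣≡1⇒adjacent (suc a) (suc b) eq  = Sum.map (Prod.map (cong suc) (cong suc)) (Prod.map (cong suc) (cong suc))
                                                  (∣-∣≡1⇒adjacent a b eq)

m≤n∸1⇒1+m≤n : ∀ {m n} → m ≢ 0 → m ≤ n ∸ 1 → suc m ≤ n
m≤n∸1⇒1+m≤n {n = zero}  m≢0 m≤0 = contradiction (ℕP.n≤0⇒n≡0 m≤0) m≢0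
m≤n∸1⇒1+m≤n {n = suc n} _   m≤n = ℕ.s≤s m≤n

T-does-xor : ∀ {A B : Set} (a? : Dec A) (b? : Dec B) → T (does a? xor does b?) → (A → ¬ B) × (¬ A → B)
T-does-xor (yes a) (no ¬b) _ = (λ _ → ¬b) , (λ ¬a → contradiction a ¬a)
T-does-xor (no ¬a) (yes b) _ = (λ a → contradiction a ¬a) , (λ _ → b)

transpose-adjacent : ∀ {a b m} → (a ≡ m × b ≡ suc m) ⊎ (a ≡ suc m × b ≡ m) →
                     ∀ u → transpose a b u ≡ transpose m (suc m) u
transpose-adjacent (inj₁ (refl , refl)) u = refl
transpose-adjacent (inj₂ (refl , refl)) u = transpose-comm _ _ u

relabel-cong : ∀ {g h} → (∀ u → g u ≡ h u) → ∀ e → relabel g e ≡ relabel h e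
relabel-cong g≗h e = cong (sign e ◃_) (g≗h ∣ e ∣)

record AdjacentDiffering (n : ℕ) (π σ : ℕ → ℤ) (a b : ℕ) : Set where
  field
    m             : ℕ
    endpoints     : (a ≡ m × b ≡ suc m) ⊎ (a ≡ suc m × b ≡ m)
    m≢0           : m ≢ 0
    1+m≤n         : suc m ≤ n
    π-des⇒σ-asc   : π (suc m) < π m → ¬ σ (suc m) < σ m
    π-asc⇒σ-des   : ¬ π (suc m) < π m → σ (suc m) < σ m

  a≢0 : a ≢ 0
  a≢0 with endpoints
  ... | inj₁ (a≡m , _)   = m≢0 ∘ trans (sym a≡m)
  ... | inj₂ (a≡1+m , _) = ℕP.1+n≢0 ∘ trans (sym a≡1+m)

  b≢0 : b ≢ 0
  b≢0 with endpoints
  ... | inj₁ (_ , b≡1+m) = ℕP.1+n≢0 ∘ trans (sym b≡1+m)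
  ... | inj₂ (_ , b≡m)   = m≢0 ∘ trans (sym b≡m)

module _ (n : ℕ) (π : List ℤ) where
  open Alg n π using (P; inner; outerLoop; step; πf)

  P-true⇒AdjacentDiffering : ∀ cs a b → P cs a b ≡ true → AdjacentDiffering n πf (cnApp cs) a b
  P-true⇒AdjacentDiffering cs a b P≡true
    with T-∧ .to (T-≡ .from P≡true)
  ... | dist , rest with T-∧ .to rest
  ... | m≢0 , rest′ with T-∧ .to rest′
  ... | m≤n∸1 , differ = record
    { m           = a ⊓ b
    ; endpoints   = ∣-∣≡1⇒adjacent a b (ℕP.≡ᵇ⇒≡ _ _ dist)
    ; m≢0         = m≢0′
    ; 1+m≤n       = 1+m≤n
    ; π-des⇒σ-asc = λ π-des σ-des → proj₁ xor-split (ℕP.m<n⇒m<1+n 1+m≤n , π-des) (1+m≤n , σ-des)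
    ; π-asc⇒σ-des = λ π-asc → proj₂ (proj₂ xor-split (π-asc ∘ proj₂))
    }
    where
    m≢0′ : a ⊓ b ≢ 0
    m≢0′ eq = subst (λ k → T (not (k ≡ᵇ 0))) eq m≢0
    1+m≤n : suc (a ⊓ b) ≤ n
    1+m≤n = m≤n∸1⇒1+m≤n m≢0′ (ℕP.≤ᵇ⇒≤ _ _ m≤n∸1)
    xor-split = T-does-xor (des? (suc n) πf (a ⊓ b)) (des? n (cnApp cs) (a ⊓ b)) differ

  Preserves : (CycleNotation → Set) → (CycleNotation → Maybe CycleNotation) → Set
  Preserves Q f = ∀ {cs cs′} → Q cs → f cs ≡ just cs′ → Q cs′

  SwapStable : (CycleNotation → Set) → Set
  SwapStable Q = ∀ cs xp yp → Q cs →
    let x = getE cs xp ; y = getE cs yp in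
    P cs ∣ x ∣ ∣ y ∣ ≡ true → Q (setE (setE cs xp (sign x ◃ ∣ y ∣)) yp (sign y ◃ ∣ x ∣))

  module _ {Q : CycleNotation → Set} (swap-stable : SwapStable Q) where

    inner-preserves : ∀ k xp yp → Preserves Q (inner k xp yp)
    inner-preserves (suc k) xp yp {cs} q eq with P cs ∣ getE cs xp ∣ ∣ getE cs yp ∣ in P≡true
    ... | false = subst Q (just-injective eq) q
    ... | true with proj₂ xp ≡ᵇ 0
    ...   | true  = inner-preserves k _ _ (swap-stable cs xp yp q P≡true) eq
    ...   | false = inner-preserves k _ _ (swap-stable cs xp yp q P≡true) eq

    outerLoop-preserves : ∀ k j ε → Preserves Q (outerLoop k j ε)
    outerLoop-preserves (suc k) j ε {cs} q eq
      with P cs ∣ getE cs (lastPos cs j) ∣ ∣ getE cs (lastPos cs j) ℤ.+ ε ∣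
    ... | false = subst Q (just-injective eq) q
    ... | true with findAbs cs ∣ getE cs (lastPos cs j) ℤ.+ ε ∣
    ...   | just yp with inner k (lastPos cs j) yp cs in inner≡
    ...     | just cs₁ = outerLoop-preserves k j ε (inner-preserves k _ yp q inner≡) eq

    step-preserves : ∀ k j → Preserves Q (step k j)
    step-preserves k j = branch _ _
      where
      branch : ∀ b ε → Preserves Q (λ cs → if b then outerLoop k j ε cs else just cs)
      branch false ε q eq = subst Q (just-injective eq) q
      branch true  ε q eq = outerLoop-preserves k j ε q eq

    bind-step-preserves : ∀ k j acc {cs} → (∀ {c} → acc ≡ just c → Q c) → (acc >>= step k j) ≡ just cs → Q cs
    bind-step-preserves k j nothing   _    ()
    bind-step-preserves k j (just c) qacc eq = step-preserves k j (qacc refl) eq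

    foldl-step-preserves : ∀ k js {acc σ} → (∀ {cs} → acc ≡ just cs → Q cs) →
      foldl (λ acc j → acc >>= step k j) acc js ≡ just σ → Q σ
    foldl-step-preserves k []       qacc eq = qacc eq
    foldl-step-preserves k (j ∷ js) {acc} qacc eq = foldl-step-preserves k js (bind-step-preserves k j acc qacc) eq

    phi-preserves : ∀ k p {σ} → Q (splitLTR p) → phi n π k p ≡ just σ → Q σ
    phi-preserves k p q = foldl-step-preserves k (upTo (length (splitLTR p))) {just (splitLTR p)} λ { refl → q }

  Invariant : CycleNotation → Set
  Invariant cs = Unique (absEntries cs) × NegBound n πf (cnApp cs)

  invariant-swapStable : SwapStable Invariant
  invariant-swapStable cs xp yp (unique , bound) P≡true =
    subst Invariant (sym (swapEntries≡relabel cs xp yp unique a≢0 b≢0))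
      (unique-relabel {cs} unique , negBound-conjugate {σ = cnApp cs} m 1+m≤n π-des⇒σ-asc π-asc⇒σ-des conjugate bound)
    where
    open AdjacentDiffering (P-true⇒AdjacentDiffering cs ∣ getE cs xp ∣ ∣ getE cs yp ∣ P≡true)
    τ = transpose ∣ getE cs xp ∣ ∣ getE cs yp ∣
    open Relabel τ (transpose-involutive _ _) (transpose-zero a≢0 b≢0)
    conjugate : ∀ v → cnApp (map (map (relabel τ)) cs) v ≡
                      relabel (transpose m (suc m)) (cnApp cs (transpose m (suc m) v))
    conjugate v = begin
      cnApp (map (map (relabel τ)) cs) v                    ≡⟨ cnApp-relabel cs v ⟩
      relabel τ (cnApp cs (τ v))                            ≡⟨ relabel-cong (transpose-adjacent endpoints) _ ⟩
      relabel (transpose m (suc m)) (cnApp cs (τ v))        ≡⟨ cong (relabel (transpose m (suc m)) ∘ cnApp cs) (transpose-adjacent endpoints v) ⟩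
      relabel (transpose m (suc m)) (cnApp cs (transpose m (suc m) v)) ∎
      where open ≡-Reasoning

-- Splitting at left-to-right maxima

consecutivePairs : List ℤ → List (ℤ × ℤ)
consecutivePairs (x ∷ y ∷ zs) = (x , y) ∷ consecutivePairs (y ∷ zs)
consecutivePairs _            = []

consecutive⇒succPair : ∀ c {q} → q ∈ consecutivePairs c → q ∈ succPairs c
consecutive⇒succPair (x ∷ xs) = go x xs
  where
  go : ∀ x xs {ys q} → q ∈ consecutivePairs (x ∷ xs) → q ∈ zip (x ∷ xs) (xs ++ ys)
  go x (y ∷ xs) (here eq)  = here eq
  go x (y ∷ xs) (there q∈) = there (go y xs q∈)

consecutive-successor : ∀ c z {e} → e ∈ c → ∃[ e′ ] (e , e′) ∈ consecutivePairs (c ++ [ z ])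
consecutive-successor (x ∷ [])     z (here refl) = z , here refl
consecutive-successor (x ∷ y ∷ xs) z (here refl) = y , here refl
consecutive-successor (x ∷ xs)     z (there e∈) with consecutive-successor xs z e∈
... | e′ , q∈ = e′ , shift xs q∈
  where
  shift : ∀ l {q} → q ∈ consecutivePairs (l ++ [ z ]) → q ∈ consecutivePairs (x ∷ l ++ [ z ])
  shift []      ()
  shift (_ ∷ _) q∈ = there q∈

consecutive-++ : ∀ c y ys {q} → q ∈ consecutivePairs (c ++ y ∷ ys) →
  q ∈ consecutivePairs c ⊎ (proj₁ q ∈ c × proj₂ q ≡ y) ⊎ q ∈ consecutivePairs (y ∷ ys)
consecutive-++ []            y ys q∈          = inj₂ (inj₂ q∈)
consecutive-++ (x ∷ [])      y ys (here refl) = inj₂ (inj₁ (here refl , refl))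
consecutive-++ (x ∷ [])      y ys (there q∈)  = inj₂ (inj₂ q∈)
consecutive-++ (x ∷ x′ ∷ xs) y ys (here refl) = inj₁ (here refl)
consecutive-++ (x ∷ x′ ∷ xs) y ys (there q∈) with consecutive-++ (x′ ∷ xs) y ys q∈
... | inj₁ q∈′              = inj₁ (there q∈′)
... | inj₂ (inj₁ (e∈ , eq)) = inj₂ (inj₁ (there e∈ , eq))
... | inj₂ (inj₂ q∈′)       = inj₂ (inj₂ q∈′)

consecutive-∣≢∣ : ∀ c {e e′} → Unique (map ∣_∣ c) → (e , e′) ∈ consecutivePairs c → ∣ e ∣ ≢ ∣ e′ ∣
consecutive-∣≢∣ (x ∷ y ∷ zs) (px ∷ _) (here refl) = All.head px
consecutive-∣≢∣ (x ∷ y ∷ zs) (_ ∷ u)  (there q∈)  = consecutive-∣≢∣ (y ∷ zs) u q∈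

∈-succPairs-++ˡ : ∀ xs {ys q} → q ∈ concatMap succPairs xs → q ∈ concatMap succPairs (xs ++ ys)
∈-succPairs-++ˡ xs {ys} q∈ = subst (_ ∈_) (sym (LP.concatMap-++ succPairs xs ys)) (∈-++⁺ˡ q∈)

∈-succPairs-last : ∀ xs c {q} → q ∈ succPairs c → q ∈ concatMap succPairs (xs ++ [ c ])
∈-succPairs-last xs c q∈ =
  subst (_ ∈_) (sym (LP.concatMap-++ succPairs xs [ c ])) (∈-++⁺ʳ (concatMap succPairs xs) (∈-++⁺ˡ q∈))

concat-splitGo : ∀ l m cur acc → concat (splitGo m cur acc l) ≡ concat acc ++ cur ++ l
concat-splitGo [] m cur acc = begin
  concat (acc ++ [ cur ])      ≡⟨ LP.concat-++ acc [ cur ] ⟨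
  concat acc ++ (cur ++ [])    ∎
  where open ≡-Reasoning
concat-splitGo (y ∷ ys) m cur acc with m ℤ.<? y
... | yes _ = begin
  concat (splitGo y [ y ] (acc ++ [ cur ]) ys)  ≡⟨ concat-splitGo ys y [ y ] (acc ++ [ cur ]) ⟩
  concat (acc ++ [ cur ]) ++ y ∷ ys             ≡⟨ cong (_++ y ∷ ys) (LP.concat-++ acc [ cur ]) ⟨
  (concat acc ++ cur ++ []) ++ y ∷ ys           ≡⟨ cong (λ c → (concat acc ++ c) ++ y ∷ ys) (LP.++-identityʳ cur) ⟩
  (concat acc ++ cur) ++ y ∷ ys                 ≡⟨ LP.++-assoc (concat acc) cur (y ∷ ys) ⟩
  concat acc ++ cur ++ y ∷ ys                   ∎
  where open ≡-Reasoning
... | no _ = trans (concat-splitGo ys m (cur ++ [ y ]) acc) (cong (concat acc ++_) (LP.++-assoc cur [ y ] ys))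

concat-splitLTR : ∀ p → concat (splitLTR p) ≡ p
concat-splitLTR []       = refl
concat-splitLTR (x ∷ xs) = concat-splitGo xs x [ x ] []

splitGo-keeps : ∀ l m cur acc {q} → q ∈ concatMap succPairs acc → q ∈ concatMap succPairs (splitGo m cur acc l)
splitGo-keeps []       m cur acc q∈ = ∈-succPairs-++ˡ acc q∈
splitGo-keeps (y ∷ ys) m cur acc q∈ with m ℤ.<? y
... | yes _ = splitGo-keeps ys y [ y ] (acc ++ [ cur ]) (∈-succPairs-++ˡ acc q∈)
... | no _  = splitGo-keeps ys m (cur ++ [ y ]) acc q∈

-- A descent (e , e′) never straddles two blocks: e′ < e ≤ (current maximum) rules out e′ being a
-- left-to-right maximum.
splitGo-keeps-descents : ∀ l m cur acc {q} → All.All (ℤ._≤ m) cur → q ∈ consecutivePairs (cur ++ l) →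
  proj₂ q < proj₁ q → q ∈ concatMap succPairs (splitGo m cur acc l)
splitGo-keeps-descents [] m cur acc _ q∈ _ rewrite LP.++-identityʳ cur =
  ∈-succPairs-last acc cur (consecutive⇒succPair cur q∈)
splitGo-keeps-descents (y ∷ ys) m cur acc cur≤m q∈ des with m ℤ.<? y | consecutive-++ cur y ys q∈
... | yes _   | inj₁ q∈cur = splitGo-keeps ys y [ y ] (acc ++ [ cur ]) (∈-succPairs-last acc cur (consecutive⇒succPair cur q∈cur))
... | yes m<y | inj₂ (inj₁ (e∈cur , refl)) = contradiction (ℤP.<-≤-trans des (All.lookup cur≤m e∈cur)) (ℤP.<-asym m<y)
... | yes _   | inj₂ (inj₂ q∈rest) = splitGo-keeps-descents ys y [ y ] (acc ++ [ cur ]) (ℤP.≤-refl All.∷ All.[]) q∈rest des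
... | no m≮y  | _ = splitGo-keeps-descents ys m (cur ++ [ y ]) acc (All.++⁺ cur≤m (ℤP.≮⇒≥ m≮y All.∷ All.[]))
                      (subst (λ l → _ ∈ consecutivePairs l) (sym (LP.++-assoc cur [ y ] ys)) q∈) des

splitLTR-keeps-descents : ∀ p {q} → q ∈ consecutivePairs p → proj₂ q < proj₁ q →
                          q ∈ concatMap succPairs (splitLTR p)
splitLTR-keeps-descents (x ∷ xs) = splitGo-keeps-descents xs x [ x ] [] (ℤP.≤-refl All.∷ All.[])

-- The initial cycle notation

map-proj₁-zip : ∀ (xs ys : List ℤ) → length xs ≤ length ys → map proj₁ (zip xs ys) ≡ xs
map-proj₁-zip []       _        _           = refl
map-proj₁-zip (x ∷ xs) (y ∷ ys) (ℕ.s≤s len) = cong (x ∷_) (map-proj₁-zip xs ys len)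

firstAbs-succPairs : ∀ c → map (∣_∣ ∘ proj₁) (succPairs c) ≡ map ∣_∣ c
firstAbs-succPairs []       = refl
firstAbs-succPairs (x ∷ xs) = begin
  map (∣_∣ ∘ proj₁) (succPairs (x ∷ xs))       ≡⟨ LP.map-∘ (succPairs (x ∷ xs)) ⟩
  map ∣_∣ (map proj₁ (zip (x ∷ xs) (xs ++ [ x ]))) ≡⟨ cong (map ∣_∣) (map-proj₁-zip (x ∷ xs) (xs ++ [ x ]) len) ⟩
  map ∣_∣ (x ∷ xs)                              ∎
  where
  open ≡-Reasoning
  len : suc (length xs) ≤ length (xs ++ [ x ])
  len = ℕP.≤-reflexive (trans (ℕP.+-comm 1 (length xs)) (sym (LP.length-++ xs)))

firstAbs-concatMap-succPairs : ∀ cs → map (∣_∣ ∘ proj₁) (concatMap succPairs cs) ≡ map ∣_∣ (concat cs)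
firstAbs-concatMap-succPairs cs = begin
  map (∣_∣ ∘ proj₁) (concatMap succPairs cs)  ≡⟨ LP.map-concatMap (∣_∣ ∘ proj₁) succPairs cs ⟩
  concatMap (map (∣_∣ ∘ proj₁) ∘ succPairs) cs ≡⟨ LP.concatMap-cong firstAbs-succPairs cs ⟩
  concatMap (map ∣_∣) cs                       ≡⟨ LP.concat-map cs ⟩
  map ∣_∣ (concat cs)                          ∎
  where open ≡-Reasoning

findNext-unique : ∀ ps {e e′} → Unique (map (∣_∣ ∘ proj₁) ps) → (e , e′) ∈ ps → findNext ps ∣ e ∣ ≡ e′
findNext-unique ((a , a′) ∷ ps) _ (here refl) rewrite ≡ᵇ-refl ∣ a ∣ = refl
findNext-unique ((a , a′) ∷ ps) {e} (pa ∷ u) (there q∈)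
  rewrite ≢⇒≡ᵇ-false (All.lookup pa (∈-map⁺ (∣_∣ ∘ proj₁) q∈)) = findNext-unique ps u q∈

cnApp-succPair : ∀ cs {e e′} → Unique (map ∣_∣ (concat cs)) → (e , e′) ∈ concatMap succPairs cs →
                 ∣ e ∣ ≢ 0 → cnApp cs ∣ e ∣ ≡ e′
cnApp-succPair cs {e} u q∈ e≢0 with ∣ e ∣ in ∣e∣≡
... | zero  = contradiction refl e≢0
... | suc i = trans (cong (findNext (concatMap succPairs cs)) (sym ∣e∣≡))
                (findNext-unique _ (subst Unique (sym (firstAbs-concatMap-succPairs cs)) u) q∈)

∣x∣≡1+i⇒-[1+i]≤x : ∀ {e i} → ∣ e ∣ ≡ suc i → -[1+ i ] ℤ.≤ e
∣x∣≡1+i⇒-[1+i]≤x { -[1+ w ]} refl = ℤP.≤-refl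
∣x∣≡1+i⇒-[1+i]≤x {+ x}       _    = ℤ.-≤+

x<0∧∣x∣≢1⇒x<-1 : ∀ {x} → x < 0ℤ → ∣ x ∣ ≢ 1 → x < -1ℤ
x<0∧∣x∣≢1⇒x<-1 { -[1+ zero ]}  _ ∣x∣≢1 = contradiction refl ∣x∣≢1
x<0∧∣x∣≢1⇒x<-1 { -[1+ suc w ]} _ _     = ℤ.-<- (ℕ.s≤s ℕ.z≤n)
x<0∧∣x∣≢1⇒x<-1 {+ x}          (ℤ.+<+ ()) _

module SingleCycle (n : ℕ) (π p : List ℤ)
  (cycle : IsCycleNotation (suc n) (listApp π) ((p ++ [ + suc n ]) ∷ [])) where

  private
    c  = p ++ [ + suc n ]
    πf = listApp π

  unique-c : Unique (map ∣_∣ c)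
  unique-c = Unique-++⁻ˡ (map ∣_∣ c)
    (Unique-resp-↭ (↭⇒↭ₛ (↭-sym (proj₂ cycle))) (Unique.map⁺ ℕP.suc-injective (Unique.upTo⁺ (suc n))))

  unique-p : Unique (map ∣_∣ p)
  unique-p = Unique-++⁻ˡ (map ∣_∣ p) (subst Unique (LP.map-++ ∣_∣ p [ + suc n ]) unique-c)

  entry-of : ∀ i → suc i ≤ n → ∃[ e ] e ∈ p × ∣ e ∣ ≡ suc i
  entry-of i 1+i≤n with ∈-++⁻ (map ∣_∣ c) (∈-resp-↭ (↭-sym (proj₂ cycle)) (∈-map⁺ suc (∈-upTo⁺ (ℕ.s≤s (ℕP.<⇒≤ 1+i≤n)))))
  ... | inj₁ 1+i∈c with ∈-map⁻ ∣_∣ 1+i∈c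
  ...   | e , e∈c , 1+i≡ with ∈-++⁻ p e∈c
  ...     | inj₁ e∈p        = e , e∈p , sym 1+i≡
  ...     | inj₂ (here refl) = contradiction (ℕP.suc-injective 1+i≡) (ℕP.<⇒≢ 1+i≤n)

  successor-of : ∀ i → suc i ≤ n → ∃[ e ] ∃[ e′ ] ∣ e ∣ ≡ suc i × πf (suc i) ≡ e′ × (e , e′) ∈ consecutivePairs c
  successor-of i 1+i≤n with entry-of i 1+i≤n
  ... | e , e∈p , ∣e∣≡ with consecutive-successor p (+ suc n) e∈p
  ...   | e′ , q∈ = e , e′ , ∣e∣≡ , πe≡e′ , q∈
    where
    πe≡e′ : πf (suc i) ≡ e′
    πe≡e′ = subst (λ v → πf v ≡ e′) ∣e∣≡ (All.lookup (proj₂ (All.head (proj₁ cycle))) (consecutive⇒succPair c q∈))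

  π[1]<-1 : 1 ≤ n → πf 1 < 0ℤ → πf 1 < -1ℤ
  π[1]<-1 1≤n π1<0 with successor-of 0 1≤n
  ... | e , e′ , ∣e∣≡1 , π1≡e′ , q∈ =
    x<0∧∣x∣≢1⇒x<-1 π1<0 λ ∣π1∣≡1 → consecutive-∣≢∣ c unique-c q∈ (trans ∣e∣≡1 (sym (trans (cong ∣_∣ (sym π1≡e′)) ∣π1∣≡1)))

  -- Below −(i+1), the step of π out of ±(i+1) is a descent inside p, which the splitting keeps.
  cnApp-splitLTR-agrees : ∀ i → suc i ≤ n → πf (suc i) < -[1+ i ] → cnApp (splitLTR p) (suc i) ≡ πf (suc i)
  cnApp-splitLTR-agrees i 1+i≤n π< with successor-of i 1+i≤n
  ... | e , e′ , ∣e∣≡ , πe≡e′ , q∈ with consecutive-++ p (+ suc n) [] q∈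
  ...   | inj₂ (inj₁ (_ , e′≡n+1)) = contradiction (subst (_< -[1+ i ]) (trans πe≡e′ e′≡n+1) π<) λ ()
  ...   | inj₁ q∈p = begin
    cnApp (splitLTR p) (suc i)   ≡⟨ cong (cnApp (splitLTR p)) ∣e∣≡ ⟨
    cnApp (splitLTR p) ∣ e ∣     ≡⟨ cnApp-succPair (splitLTR p) unique-concat (splitLTR-keeps-descents p q∈p e′<e)
                                      (ℕP.1+n≢0 ∘ trans (sym ∣e∣≡)) ⟩
    e′                           ≡⟨ πe≡e′ ⟨
    πf (suc i)                   ∎
    where
    open ≡-Reasoning
    e′<e : e′ < e
    e′<e = ℤP.<-≤-trans (subst (_< -[1+ i ]) πe≡e′ π<) (∣x∣≡1+i⇒-[1+i]≤x ∣e∣≡)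
    unique-concat : Unique (map ∣_∣ (concat (splitLTR p)))
    unique-concat = subst (Unique ∘ map ∣_∣) (sym (concat-splitLTR p)) unique-p

  initialInvariant : πf 1 < -1ℤ → Invariant n π (splitLTR p)
  initialInvariant π1< = unique-entries , bound
    where
    unique-entries : Unique (absEntries (splitLTR p))
    unique-entries = subst Unique (sym (trans (LP.concat-map (splitLTR p)) (cong (map ∣_∣) (concat-splitLTR p)))) unique-p
    bound : NegBound n πf (cnApp (splitLTR p))
    bound i 1+i≤n run = subst (_< -[1+ i ]) (sym (cnApp-splitLTR-agrees i 1+i≤n π<)) π<
      where
      π< : πf (suc i) < -[1+ i ]
      π< = descentRun-below π1< i run

corollary3p29 : (n : ℕ) → 1 ≤ n →
    (π : List ℤ) → IsSignedPerm (suc n) π →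
    (p : List ℤ) → IsCycleNotation (suc n) (listApp π) ((p ++ [ + suc n ]) ∷ []) →
    Des (suc n) (listApp π) 0 →
    (k : ℕ) (σ : CycleNotation) → phi n π k p ≡ just σ →
    Des n (cnApp σ) 0 × (listApp π 1 < -1ℤ) × (cnApp σ 1 < -1ℤ)
corollary3p29 n 1≤n π _ p cycle (_ , π1<π0) k σ φπ≡σ = (1≤n , ℤP.<-trans σ1<-1 ℤ.-<+) , π1<-1 , σ1<-1
  where
  open SingleCycle n π p cycle
  π1<-1 : listApp π 1 < -1ℤ
  π1<-1 = π[1]<-1 1≤n π1<π0
  σ-invariant : Invariant n π σ
  σ-invariant = phi-preserves n π (invariant-swapStable n π) k p (initialInvariant π1<-1) φπ≡σ
  σ1<-1 : cnApp σ 1 < -1ℤ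
  σ1<-1 = proj₂ σ-invariant 0 1≤n (DescentRun-one {listApp π} π1<π0)
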